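{- Let $q=3$, let $p>3$ be prime, $g=p-1$, and $m=\lfloor (p-4)/3\rfloor+1$. Then the matrix $\gamma_q$ (defined with the generator $d=2$ of $(\mathbb{Z}/3\mathbb{Z})^\times$) is $$\gamma_q=\begin{pmatrix}0&I_{2m}&0\\ I_{2m}&0&0\\ 0&0&J_{g-2m}\end{pmatrix},$$ where $I_{2m}$ is the $2m\times2m$ identity matrix and $J_{g-2m}=\mathrm{antidiag}(J,\dots,J)$ is the $2(g-2m)\times 2(g-2m)$ block anti-diagonal matrix with $g-2m$ blocks equal to $J$ on the block anti-diagonal.
   Context: $J=\begin{pmatrix}0&1\\-1&0\end{pmatrix}$, $I$ the $2\times2$ identity. Notation: $\langle x\rangle_r$ is the representative of $x$ mod $r$ in $\{0,\dots,r-1\}$. For general distinct odd primes $p,q$ with $g=(p-1)(q-1)/2$: for $1\le b\le q-1$ let $k_b=\lfloor (pb-q-1)/q\rfloor$; for $0\le t\le q-1$ let $\kappa_t=\sum_{1\le b\le t,\ k_b\ge0}(k_b+1)$ (so $\kappa_0=0$). The integer pairs $(a,b)$ with $1\le b\le q-1$, $0\le a\le k_b$ are exactly $g$ in number; order them by increasing $b$ then increasing $a$ and let $(a_i,b_i)$ be the $i$-th pair. A $2g\times2g$ matrix $X$ has $2\times2$ blocks $X[i,j]$. For a generator $d$ of $(\mathbb{Z}/q\mathbb{Z})^\times$, $\gamma_q$ is the $2g\times 2g$ matrix with, writing $t_i=\langle db_i\rangle_q$ and $t_i'=q-t_i$: $\gamma_q[i,j]=I$ if $0\le a_i\le k_{t_i}$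 and $j=\kappa_{t_i-1}+a_i+1$; $\gamma_q[i,j]=J$ if $a_i>k_{t_i}$ and $j=\kappa_{t_i'-1}+p-(a_i+1)$; $\gamma_q[i,j]=0$ otherwise. -}

module Defs where

open import Data.Nat as ℕ using (ℕ; zero; suc; _+_; _*_; _∸_; _/_; _%_)
open import Data.Nat.DivMod using (m%n<n)
open import Data.Integer as ℤ using (ℤ; +_; -[1+_])
open import Data.Fin using (Fin; toℕ; fromℕ<; splitAt)
open import Data.Sum using (_⊎_; inj₁; inj₂)
open import Data.List using (List; []; _∷_; _++_; map; upTo; concatMap; length; sum)
open import Data.Product using (_×_; _,_; proj₁; proj₂)
open import Data.Maybe using (Maybe; just; nothing)
open import Relation.Nullary using (yes; no)
open import Relation.Nullary.Decidable using (⌊_⌋)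
open import Data.Bool using (Bool; true; false; if_then_else_; _∧_)

Mat : ℕ → ℕ → Set
Mat m n = Fin m → Fin n → ℤ

zeroM : ∀ {m n} → Mat m n
zeroM _ _ = + 0

idM : ∀ n → Mat n n
idM n i j = if ⌊ toℕ i ℕ.≟ toℕ j ⌋ then + 1 else + 0

I₂ : Mat 2 2
I₂ = idM 2

J₂ : Mat 2 2
J₂ Fin.zero Fin.zero = + 0
J₂ Fin.zero (Fin.suc Fin.zero) = + 1
J₂ (Fin.suc Fin.zero) Fin.zero = -[1+ 0 ]
J₂ (Fin.suc Fin.zero) (Fin.suc Fin.zero) = + 0

-- A (2k)×(2k) matrix given by its 2×2 blocks X[i,j], with 1-based block
-- indices i, j ∈ {1,…,k}:  entry (r,c) (0-based) lies in block
-- (⌊r/2⌋+1, ⌊c/2⌋+1) at position (r mod 2, c mod 2).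
fromBlocks : ∀ k → (ℕ → ℕ → Mat 2 2) → Mat (2 * k) (2 * k)
fromBlocks k X r c =
  X (toℕ r / 2 + 1) (toℕ c / 2 + 1)
    (fromℕ< (m%n<n (toℕ r) 2)) (fromℕ< (m%n<n (toℕ c) 2))

block3 : ∀ {a b c} →
  Mat a a → Mat a b → Mat a c →
  Mat b a → Mat b b → Mat b c →
  Mat c a → Mat c b → Mat c c → Mat (a + b + c) (a + b + c)
block3 {a} {b} {c} A11 A12 A13 A21 A22 A23 A31 A32 A33 r s
  with splitAt (a + b) r | splitAt (a + b) s
... | inj₂ r' | inj₂ s' = A33 r' s'
... | inj₂ r' | inj₁ s₀ with splitAt a s₀
...   | inj₁ s' = A31 r' s'
...   | inj₂ s' = A32 r' s'
block3 {a} {b} {c} A11 A12 A13 A21 A22 A23 A31 A32 A33 r s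
    | inj₁ r₀ | inj₂ s' with splitAt a r₀
...   | inj₁ r' = A13 r' s'
...   | inj₂ r' = A23 r' s'
block3 {a} {b} {c} A11 A12 A13 A21 A22 A23 A31 A32 A33 r s
    | inj₁ r₀ | inj₁ s₀ with splitAt a r₀ | splitAt a s₀
...   | inj₁ r' | inj₁ s' = A11 r' s'
...   | inj₁ r' | inj₂ s' = A12 r' s'
...   | inj₂ r' | inj₁ s' = A21 r' s'
...   | inj₂ r' | inj₂ s' = A22 r' s'

antidiagJ : ∀ k → Mat (2 * k) (2 * k)
antidiagJ k = fromBlocks k X
  where
  X : ℕ → ℕ → Mat 2 2
  X i j = if ⌊ i + j ℕ.≟ k + 1 ⌋ then J₂ else zeroM

genus : ℕ → ℕ → ℕ
genus p q = ((p ∸ 1) * (q ∸ 1)) / 2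

kk : (p q : ℕ) .{{_ : ℕ.NonZero q}} → ℕ → ℤ
kk p q b = ((+ (p * b)) ℤ.- (+ q) ℤ.- (+ 1)) ℤ./ℕ q
  -- _/ℕ_ is floor division (rounds towards -∞)

-- number of pairs (a,b) with 0 ≤ a ≤ k_b for a given b, i.e. k_b + 1 if k_b ≥ 0
cnt : ℤ → ℕ
cnt (+ n) = suc n
cnt -[1+ n ] = 0

κ : (p q : ℕ) .{{_ : ℕ.NonZero q}} → ℕ → ℕ
κ p q zero = 0
κ p q (suc t) = κ p q t + cnt (kk p q (suc t))

pairs : (p q : ℕ) .{{_ : ℕ.NonZero q}} → List (ℕ × ℕ)
pairs p q = concatMap (λ b → map (λ a → (a , b)) (upTo (cnt (kk p q b))))
                      (map suc (upTo (q ∸ 1)))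

-- 1-based lookup
nth : ∀ {A : Set} → List A → ℕ → Maybe A
nth [] _ = nothing
nth (x ∷ xs) zero = nothing
nth (x ∷ xs) (suc zero) = just x
nth (x ∷ xs) (suc (suc i)) = nth xs (suc i)

γBlock : (p q d : ℕ) .{{_ : ℕ.NonZero q}} → ℕ → ℕ → Mat 2 2
γBlock p q d i j with nth (pairs p q) i
... | nothing = zeroM
... | just (a , b) =
  if ⌊ (+ a) ℤ.≤? kk p q t ⌋
  then (if ⌊ j ℕ.≟ κ p q (t ∸ 1) + a + 1 ⌋ then I₂ else zeroM)
  else (if ⌊ (+ j) ℤ.≟ (+ κ p q (t' ∸ 1)) ℤ.+ (+ p) ℤ.- (+ (a + 1)) ⌋ then J₂ else zeroM)
  where
  t  = (d * b) % q
  t' = q ∸ t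

γ : (p q d : ℕ) .{{_ : ℕ.NonZero q}} → Mat (2 * genus p q) (2 * genus p q)
γ p q d = fromBlocks (genus p q) (γBlock p q d)

{-# OPTIONS --safe #-}
-- For q = 3 and d = 2 the pairs are (a,1) with a < m and then (a,2) with a < m + h, where
-- m = k₁ + 1 and, because 3 ∤ p, k₁ + k₂ + 2 = g = 2m + h. Multiplication by 2 exchanges
-- b = 1 and b = 2, so the block row of (a,1) carries I at block column m + a + 1, the row of
-- (a,2) with a ≤ k₁ carries I at column a + 1, and the row of (a,2) with a > k₁ carries J at
-- column m + p − (a + 1), which is the anti-diagonal of the last h block rows and columns.
-- To compare entries, both sides are described by functions on ℕ × ℕ: block3 becomes a
-- concatenation of index ranges, and cutting into 2×2 blocks commutes with that concatenation.
module Submission where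

open import Data.Bool using (if_then_else_)
open import Data.Fin as Fin using (Fin; toℕ; fromℕ<; splitAt; cast)
import Data.Fin.Properties as Finₚ
open import Data.Integer as ℤ using (ℤ; +_)
import Data.Integer.Properties as ℤₚ
open import Data.List using ([]; _++_; map; applyUpTo; upTo)
open import Data.List.Properties using (map-applyUpTo)
open import Data.Maybe using (just; nothing)
open import Data.Nat as ℕ using (ℕ; zero; suc; _+_; _*_; _∸_; _/_; _%_; _≤_; _<_; _≟_; _<?_; z≤n; s≤s)
open import Data.Nat.DivMod
open import Data.Nat.Divisibility using (divides)
open import Data.Nat.Primality using (Prime; composite)
open import Data.Nat.Properties
open import Data.Nat.Tactic.RingSolver using (solve-∀)
open import Data.Product using (Σ; ∃; _×_; _,_)
open import Data.Sum as Sum using (_⊎_; inj₁; inj₂; [_,_]′)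
open import Function using (id; _∘_; _$_; const; _⇔_; mk⇔)
open import Relation.Binary.PropositionalEquality
open import Relation.Nullary using (Dec; yes; no; ¬_; contradiction)
open import Relation.Nullary.Decidable using (⌊_⌋; isYes≗does; dec-true; dec-false; does-⇔)

open import Defs

module _ {ℓ} {P : Set ℓ} {A : Set} {x y : A} where

  if-yes : (d : Dec P) → P → (if ⌊ d ⌋ then x else y) ≡ x
  if-yes d p = cong (if_then x else y) (trans (isYes≗does d) (dec-true d p))

  if-no : (d : Dec P) → ¬ P → (if ⌊ d ⌋ then x else y) ≡ y
  if-no d ¬p = cong (if_then x else y) (trans (isYes≗does d) (dec-false d ¬p))

  if-⇔ : ∀ {q} {Q : Set q} (d : Dec P) (e : Dec Q) → P ⇔ Q →
         (if ⌊ d ⌋ then x else y) ≡ (if ⌊ e ⌋ then x else y)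
  if-⇔ d e P⇔Q = cong (if_then x else y)
    (trans (isYes≗does d) (trans (does-⇔ P⇔Q d e) (sym (isYes≗does e))))

-- Concatenation of index ranges

splitAtℕ : ℕ → ℕ → ℕ ⊎ ℕ
splitAtℕ zero    n       = inj₂ n
splitAtℕ (suc a) zero    = inj₁ zero
splitAtℕ (suc a) (suc n) = Sum.map₁ suc (splitAtℕ a n)

splitAtℕ-toℕ : ∀ a {b} (i : Fin (a + b)) →
               splitAtℕ a (toℕ i) ≡ Sum.map toℕ toℕ (splitAt a i)
splitAtℕ-toℕ zero    i           = refl
splitAtℕ-toℕ (suc a) Fin.zero    = refl
splitAtℕ-toℕ (suc a) (Fin.suc i) rewrite splitAtℕ-toℕ a i with splitAt a i
... | inj₁ _ = refl
... | inj₂ _ = refl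

splitAt⇒splitAtℕ : ∀ {a b} {i : Fin (a + b)} {s} →
                   splitAt a i ≡ s → splitAtℕ a (toℕ i) ≡ Sum.map toℕ toℕ s
splitAt⇒splitAtℕ {a} {i = i} refl = splitAtℕ-toℕ a i

splitAtℕ-< : ∀ {a n} → n < a → splitAtℕ a n ≡ inj₁ n
splitAtℕ-< {suc a} {zero}  _         = refl
splitAtℕ-< {suc a} {suc n} (s≤s n<a) = cong (Sum.map₁ suc) (splitAtℕ-< n<a)

splitAtℕ-+ : ∀ a n → splitAtℕ a (a + n) ≡ inj₂ n
splitAtℕ-+ zero    n = refl
splitAtℕ-+ (suc a) n = cong (Sum.map₁ suc) (splitAtℕ-+ a n)

data Position (a : ℕ) : ℕ → Set where
  before : ∀ {n} → n < a → Position a n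
  after  : ∀ n → Position a (a + n)

position : ∀ a n → Position a n
position a n with n <? a
... | yes n<a = before n<a
... | no  n≮a = subst (Position a) (m+[n∸m]≡n (≮⇒≥ n≮a)) (after (n ∸ a))

-- Splitting at a + b first and then at a, as block3 does, lets block3-tabulates go through
-- by rewriting alone.
concat₃ : ∀ {A : Set} → ℕ → ℕ → (ℕ → A) → (ℕ → A) → (ℕ → A) → ℕ → A
concat₃ a b u v w = [ [ u , v ]′ ∘ splitAtℕ a , w ]′ ∘ splitAtℕ (a + b)

module _ {A : Set} (a b : ℕ) where

  module _ {u v w : ℕ → A} where

    concat₃-first : ∀ {n} → n < a → concat₃ a b u v w n ≡ u n
    concat₃-first n<a rewrite splitAtℕ-< (≤-trans n<a (m≤m+n a b)) | splitAtℕ-< n<a = refl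

    concat₃-second : ∀ {n} → n < b → concat₃ a b u v w (a + n) ≡ v n
    concat₃-second {n} n<b rewrite splitAtℕ-< (+-monoʳ-< a n<b) | splitAtℕ-+ a n = refl

    concat₃-third : ∀ n → concat₃ a b u v w (a + (b + n)) ≡ w n
    concat₃-third n rewrite sym (+-assoc a b n) | splitAtℕ-+ (a + b) n = refl

  concat₃-map : ∀ {B : Set} (f : A → B) {u v w : ℕ → A} {u′ v′ w′ : ℕ → B} →
                (∀ n → f (u n) ≡ u′ n) → (∀ n → f (v n) ≡ v′ n) → (∀ n → f (w n) ≡ w′ n) →
                ∀ n → f (concat₃ a b u v w n) ≡ concat₃ a b u′ v′ w′ n
  concat₃-map f fu fv fw n with splitAtℕ (a + b) n
  ... | inj₂ n′ = fw n′
  ... | inj₁ n′ with splitAtℕ a n′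
  ...   | inj₁ n″ = fu n″
  ...   | inj₂ n″ = fv n″

  concat₃-const : ∀ (o : A) n → concat₃ a b (const o) (const o) (const o) n ≡ o
  concat₃-const o n with splitAtℕ (a + b) n
  ... | inj₂ _ = refl
  ... | inj₁ n′ with splitAtℕ a n′
  ...   | inj₁ _ = refl
  ...   | inj₂ _ = refl

module _ {A : Set} (o : A) where

  single : ℕ → A → ℕ → A
  single j x n = if ⌊ n ≟ j ⌋ then x else o

  single-≢ : ∀ {j x n} → n ≢ j → single j x n ≡ o
  single-≢ {j} {n = n} = if-no (n ≟ j)

  single-+ : ∀ a {j x n} → single (a + j) x (a + n) ≡ single j x n
  single-+ a {j} {n = n} =
    if-⇔ (a + n ≟ a + j) (n ≟ j) (mk⇔ (+-cancelˡ-≡ a n j) (cong (_+_ a)))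

  module _ (a b : ℕ) {j : ℕ} {x : A} where

    concat₃-single₁ : j < a → concat₃ a b (single j x) (const o) (const o) ≗ single j x
    concat₃-single₁ j<a n with position a n
    ... | before n<a = concat₃-first a b n<a
    ... | after n′ with position b n′
    ...   | before n′<b = trans (concat₃-second a b n′<b)
                                (sym (single-≢ (>⇒≢ (≤-trans j<a (m≤m+n a n′)))))
    ...   | after n″    = trans (concat₃-third a b n″)
                                (sym (single-≢ (>⇒≢ (≤-trans j<a (m≤m+n a (b + n″))))))

    concat₃-single₂ : j < b → concat₃ a b (const o) (single j x) (const o) ≗ single (a + j) x
    concat₃-single₂ j<b n with position a n
    ... | before n<a = trans (concat₃-first a b n<a)
                             (sym (single-≢ (<⇒≢ (≤-trans n<a (m≤m+n a j)))))
    ... | after n′ with position b n′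
    ...   | before n′<b = trans (concat₃-second a b n′<b) (sym (single-+ a))
    ...   | after n″    = trans (concat₃-third a b n″)
                                (sym (trans (single-+ a) (single-≢ (>⇒≢ (≤-trans j<b (m≤m+n b n″))))))

    concat₃-single₃ : concat₃ a b (const o) (const o) (single j x) ≗ single (a + (b + j)) x
    concat₃-single₃ n with position a n
    ... | before n<a = trans (concat₃-first a b n<a)
                             (sym (single-≢ (<⇒≢ (≤-trans n<a (m≤m+n a (b + j))))))
    ... | after n′ with position b n′
    ...   | before n′<b = trans (concat₃-second a b n′<b)
                                (sym (trans (single-+ a) (single-≢ (<⇒≢ (≤-trans n′<b (m≤m+n b j))))))
    ...   | after n″    = trans (concat₃-third a b n″) (sym (trans (single-+ a) (single-+ b)))

-- Matrices described by their entries

blockRow : ∀ {A : Set} → ℕ → ℕ → (f g h : ℕ → ℕ → A) → ℕ → ℕ → A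
blockRow a b f g h x = concat₃ a b (f x) (g x) (h x)

block3ℕ : ∀ {A : Set} → ℕ → ℕ → (f₁₁ f₁₂ f₁₃ f₂₁ f₂₂ f₂₃ f₃₁ f₃₂ f₃₃ : ℕ → ℕ → A) → ℕ → ℕ → A
block3ℕ a b f₁₁ f₁₂ f₁₃ f₂₁ f₂₂ f₂₃ f₃₁ f₃₂ f₃₃ =
  concat₃ a b (blockRow a b f₁₁ f₁₂ f₁₃) (blockRow a b f₂₁ f₂₂ f₂₃) (blockRow a b f₃₁ f₃₂ f₃₃)

Tabulates : ∀ {m n} → (ℕ → ℕ → ℤ) → Mat m n → Set
Tabulates f M = ∀ r c → M r c ≡ f (toℕ r) (toℕ c)

block3-tabulates :
  ∀ {a b c} {A₁₁ : Mat a a} {A₁₂ : Mat a b} {A₁₃ : Mat a c}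
    {A₂₁ : Mat b a} {A₂₂ : Mat b b} {A₂₃ : Mat b c}
    {A₃₁ : Mat c a} {A₃₂ : Mat c b} {A₃₃ : Mat c c}
    {f₁₁ f₁₂ f₁₃ f₂₁ f₂₂ f₂₃ f₃₁ f₃₂ f₃₃ : ℕ → ℕ → ℤ} →
  Tabulates f₁₁ A₁₁ → Tabulates f₁₂ A₁₂ → Tabulates f₁₃ A₁₃ →
  Tabulates f₂₁ A₂₁ → Tabulates f₂₂ A₂₂ → Tabulates f₂₃ A₂₃ →
  Tabulates f₃₁ A₃₁ → Tabulates f₃₂ A₃₂ → Tabulates f₃₃ A₃₃ →
  Tabulates (block3ℕ a b f₁₁ f₁₂ f₁₃ f₂₁ f₂₂ f₂₃ f₃₁ f₃₂ f₃₃)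
            (block3 A₁₁ A₁₂ A₁₃ A₂₁ A₂₂ A₂₃ A₃₁ A₃₂ A₃₃)
block3-tabulates {a} {b} t₁₁ t₁₂ t₁₃ t₂₁ t₂₂ t₂₃ t₃₁ t₃₂ t₃₃ r s
  with splitAt (a + b) r in r↦ | splitAt (a + b) s in s↦
... | inj₂ r′ | inj₂ s′ rewrite splitAt⇒splitAtℕ r↦ | splitAt⇒splitAtℕ s↦ = t₃₃ r′ s′
... | inj₂ r′ | inj₁ s₀ with splitAt a s₀ in s₀↦
...   | inj₁ s′ rewrite splitAt⇒splitAtℕ r↦ | splitAt⇒splitAtℕ s↦ | splitAt⇒splitAtℕ s₀↦
  = t₃₁ r′ s′
...   | inj₂ s′ rewrite splitAt⇒splitAtℕ r↦ | splitAt⇒splitAtℕ s↦ | splitAt⇒splitAtℕ s₀↦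
  = t₃₂ r′ s′
block3-tabulates {a} {b} t₁₁ t₁₂ t₁₃ t₂₁ t₂₂ t₂₃ t₃₁ t₃₂ t₃₃ r s
    | inj₁ r₀ | inj₂ s′ with splitAt a r₀ in r₀↦
...   | inj₁ r′ rewrite splitAt⇒splitAtℕ r↦ | splitAt⇒splitAtℕ r₀↦ | splitAt⇒splitAtℕ s↦
  = t₁₃ r′ s′
...   | inj₂ r′ rewrite splitAt⇒splitAtℕ r↦ | splitAt⇒splitAtℕ r₀↦ | splitAt⇒splitAtℕ s↦
  = t₂₃ r′ s′
block3-tabulates {a} {b} t₁₁ t₁₂ t₁₃ t₂₁ t₂₂ t₂₃ t₃₁ t₃₂ t₃₃ r s
    | inj₁ r₀ | inj₁ s₀ with splitAt a r₀ in r₀↦ | splitAt a s₀ in s₀↦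
... | inj₁ r′ | inj₁ s′ rewrite splitAt⇒splitAtℕ r↦ | splitAt⇒splitAtℕ r₀↦
                              | splitAt⇒splitAtℕ s↦ | splitAt⇒splitAtℕ s₀↦ = t₁₁ r′ s′
... | inj₁ r′ | inj₂ s′ rewrite splitAt⇒splitAtℕ r↦ | splitAt⇒splitAtℕ r₀↦
                              | splitAt⇒splitAtℕ s↦ | splitAt⇒splitAtℕ s₀↦ = t₁₂ r′ s′
... | inj₂ r′ | inj₁ s′ rewrite splitAt⇒splitAtℕ r↦ | splitAt⇒splitAtℕ r₀↦
                              | splitAt⇒splitAtℕ s↦ | splitAt⇒splitAtℕ s₀↦ = t₂₁ r′ s′
... | inj₂ r′ | inj₂ s′ rewrite splitAt⇒splitAtℕ r↦ | splitAt⇒splitAtℕ r₀↦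
                              | splitAt⇒splitAtℕ s↦ | splitAt⇒splitAtℕ s₀↦ = t₂₂ r′ s′

-- 2×2 blocks

parity : ℕ → Fin 2
parity n = fromℕ< (m%n<n n 2)

unblock : ∀ {A : Set} → (ℕ → Fin 2 → A) → ℕ → A
unblock u n = u (n / 2) (parity n)

-- Block indices start at 0 here, whereas fromBlocks and γBlock count blocks from 1.
blockEntries : (ℕ → ℕ → Mat 2 2) → ℕ → ℕ → ℤ
blockEntries X = unblock (λ x i → unblock (λ y j → X x y i j))

n<2a⇒n/2<a : ∀ {a n} → n < 2 * a → n / 2 < a
n<2a⇒n/2<a {a} {n} n<2a = m<n*o⇒m/o<n (subst (n <_) (*-comm 2 a) n<2a)

unblock-shift : ∀ {A : Set} (u : ℕ → Fin 2 → A) a n →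
                unblock u (2 * a + n) ≡ unblock (λ x → u (a + x)) n
unblock-shift u a n rewrite *-comm 2 a =
  cong₂ u half (Finₚ.fromℕ<-cong _ _ rem (m%n<n (a * 2 + n) 2) (m%n<n n 2))
  where
  half : (a * 2 + n) / 2 ≡ a + n / 2
  half = trans (+-distrib-/-∣ˡ n (divides a refl)) (cong (_+ n / 2) (m*n/n≡m a 2))
  rem : (a * 2 + n) % 2 ≡ n % 2
  rem = trans (cong (_% 2) (+-comm (a * 2) n)) ([m+kn]%n≡m%n n a 2)

concat₃-unblock : ∀ {A : Set} a b (u v w : ℕ → Fin 2 → A) n →
  concat₃ (2 * a) (2 * b) (unblock u) (unblock v) (unblock w) n ≡ unblock (concat₃ a b u v w) n
concat₃-unblock a b u v w n with position (2 * a) n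
... | before n<2a = begin
  concat₃ (2 * a) (2 * b) (unblock u) (unblock v) (unblock w) n
    ≡⟨ concat₃-first (2 * a) (2 * b) n<2a ⟩
  unblock u n
    ≡⟨ cong-app (concat₃-first a b (n<2a⇒n/2<a n<2a)) (parity n) ⟨
  unblock (concat₃ a b u v w) n ∎
  where open ≡-Reasoning
... | after n′ with position (2 * b) n′
...   | before n′<2b = begin
  concat₃ (2 * a) (2 * b) (unblock u) (unblock v) (unblock w) (2 * a + n′)
    ≡⟨ concat₃-second (2 * a) (2 * b) n′<2b ⟩
  unblock v n′
    ≡⟨ cong-app (concat₃-second a b (n<2a⇒n/2<a n′<2b)) (parity n′) ⟨
  unblock (λ x → concat₃ a b u v w (a + x)) n′
    ≡⟨ unblock-shift (concat₃ a b u v w) a n′ ⟨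
  unblock (concat₃ a b u v w) (2 * a + n′) ∎
  where open ≡-Reasoning
...   | after n″ = begin
  concat₃ (2 * a) (2 * b) (unblock u) (unblock v) (unblock w) (2 * a + (2 * b + n″))
    ≡⟨ concat₃-third (2 * a) (2 * b) n″ ⟩
  unblock w n″
    ≡⟨ cong-app (concat₃-third a b (n″ / 2)) (parity n″) ⟨
  unblock (λ x → concat₃ a b u v w (a + (b + x))) n″
    ≡⟨ unblock-shift (λ x → concat₃ a b u v w (a + x)) b n″ ⟨
  unblock (λ x → concat₃ a b u v w (a + x)) (2 * b + n″)
    ≡⟨ unblock-shift (concat₃ a b u v w) a (2 * b + n″) ⟨
  unblock (concat₃ a b u v w) (2 * a + (2 * b + n″)) ∎
  where open ≡-Reasoning

block3ℕ-blockEntries :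
  ∀ a b (X₁₁ X₁₂ X₁₃ X₂₁ X₂₂ X₂₃ X₃₁ X₃₂ X₃₃ : ℕ → ℕ → Mat 2 2) R C →
  block3ℕ (2 * a) (2 * b)
    (blockEntries X₁₁) (blockEntries X₁₂) (blockEntries X₁₃)
    (blockEntries X₂₁) (blockEntries X₂₂) (blockEntries X₂₃)
    (blockEntries X₃₁) (blockEntries X₃₂) (blockEntries X₃₃) R C
  ≡ blockEntries (block3ℕ a b X₁₁ X₁₂ X₁₃ X₂₁ X₂₂ X₂₃ X₃₁ X₃₂ X₃₃) R C
block3ℕ-blockEntries a b X₁₁ X₁₂ X₁₃ X₂₁ X₂₂ X₂₃ X₃₁ X₃₂ X₃₃ R C = begin
  block3ℕ (2 * a) (2 * b)
    (blockEntries X₁₁) (blockEntries X₁₂) (blockEntries X₁₃)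
    (blockEntries X₂₁) (blockEntries X₂₂) (blockEntries X₂₃)
    (blockEntries X₃₁) (blockEntries X₃₂) (blockEntries X₃₃) R C
    ≡⟨ concat₃-map (2 * a) (2 * b) (_$ C)
         (columns X₁₁ X₁₂ X₁₃) (columns X₂₁ X₂₂ X₂₃) (columns X₃₁ X₃₂ X₃₃) R ⟩
  concat₃ (2 * a) (2 * b) (unblock (U X₁₁ X₁₂ X₁₃)) (unblock (U X₂₁ X₂₂ X₂₃))
                          (unblock (U X₃₁ X₃₂ X₃₃)) R
    ≡⟨ concat₃-unblock a b (U X₁₁ X₁₂ X₁₃) (U X₂₁ X₂₂ X₂₃) (U X₃₁ X₃₂ X₃₃) R ⟩
  concat₃ a b (U X₁₁ X₁₂ X₁₃) (U X₂₁ X₂₂ X₂₃) (U X₃₁ X₃₂ X₃₃) (R / 2) (parity R)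
    ≡⟨ concat₃-map a b (_$ parity R)
         (entry X₁₁ X₁₂ X₁₃) (entry X₂₁ X₂₂ X₂₃) (entry X₃₁ X₃₂ X₃₃) (R / 2) ⟩
  concat₃ a b (λ x → blockRow a b X₁₁ X₁₂ X₁₃ x (C / 2) (parity R) (parity C))
              (λ x → blockRow a b X₂₁ X₂₂ X₂₃ x (C / 2) (parity R) (parity C))
              (λ x → blockRow a b X₃₁ X₃₂ X₃₃ x (C / 2) (parity R) (parity C)) (R / 2)
    ≡⟨ concat₃-map a b (λ F → F (C / 2) (parity R) (parity C))
         {blockRow a b X₁₁ X₁₂ X₁₃} {blockRow a b X₂₁ X₂₂ X₂₃} {blockRow a b X₃₁ X₃₂ X₃₃}
         (λ _ → refl) (λ _ → refl) (λ _ → refl) (R / 2) ⟨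
  block3ℕ a b X₁₁ X₁₂ X₁₃ X₂₁ X₂₂ X₂₃ X₃₁ X₃₂ X₃₃ (R / 2) (C / 2) (parity R) (parity C) ∎
  where
  open ≡-Reasoning
  U : (X Y Z : ℕ → ℕ → Mat 2 2) → ℕ → Fin 2 → ℤ
  U X Y Z x i = unblock (concat₃ a b (λ y j → X x y i j) (λ y j → Y x y i j) (λ y j → Z x y i j)) C
  columns : ∀ X Y Z x →
    blockRow (2 * a) (2 * b) (blockEntries X) (blockEntries Y) (blockEntries Z) x C
    ≡ unblock (U X Y Z) x
  columns X Y Z x = concat₃-unblock a b _ _ _ C
  entry : ∀ X Y Z x → U X Y Z x (parity R) ≡ blockRow a b X Y Z x (C / 2) (parity R) (parity C)
  entry X Y Z x = trans (concat₃-map a b (_$ parity C) (λ _ → refl) (λ _ → refl) (λ _ → refl) (C / 2))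
                        (sym (concat₃-map a b (λ M → M (parity R) (parity C)) {X x} {Y x} {Z x}
                                (λ _ → refl) (λ _ → refl) (λ _ → refl) (C / 2)))

fromBlocks-tabulates : ∀ k {X} → Tabulates (blockEntries (λ x y → X (suc x) (suc y))) (fromBlocks k X)
fromBlocks-tabulates k {X} r c =
  cong₂ (λ i j → X i j (parity (toℕ r)) (parity (toℕ c))) (+-comm _ 1) (+-comm _ 1)

diagonal : ℕ → ℕ → Mat 2 2
diagonal x = single zeroM x I₂

idM-tabulates : ∀ n → Tabulates (blockEntries diagonal) (idM n)
idM-tabulates n r c = diagonal-entries (toℕ r) (toℕ c)
  where
  toℕ-parity : ∀ R → toℕ (parity R) ≡ R % 2
  toℕ-parity R = Finₚ.toℕ-fromℕ< (m%n<n R 2)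
  halves-parities-injective : ∀ {R C} → C / 2 ≡ R / 2 → toℕ (parity R) ≡ toℕ (parity C) → R ≡ C
  halves-parities-injective {R} {C} q e = begin
    R                 ≡⟨ m≡m%n+[m/n]*n R 2 ⟩
    R % 2 + R / 2 * 2 ≡⟨ cong₂ (λ i j → i + j * 2)
                               (trans (sym (toℕ-parity R)) (trans e (toℕ-parity C))) (sym q) ⟩
    C % 2 + C / 2 * 2 ≡⟨ m≡m%n+[m/n]*n C 2 ⟨
    C                 ∎
    where open ≡-Reasoning
  diagonal-entries : ∀ R C → (if ⌊ R ≟ C ⌋ then + 1 else + 0) ≡ blockEntries diagonal R C
  diagonal-entries R C with R ≟ C
  ... | yes refl rewrite ≟-diag (refl {x = R / 2}) | ≟-diag (refl {x = toℕ (parity R)}) = refl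
  ... | no R≢C with C / 2 ≟ R / 2
  ...   | no _  = refl
  ...   | yes q = sym (if-no (toℕ (parity R) ≟ toℕ (parity C)) (R≢C ∘ halves-parities-injective q))

antidiagonal : ℕ → ℕ → ℕ → Mat 2 2
antidiagonal k x y = if ⌊ suc x + suc y ≟ k + 1 ⌋ then J₂ else zeroM

antidiagJ-tabulates : ∀ k → Tabulates (blockEntries (antidiagonal k)) (antidiagJ k)
antidiagJ-tabulates k = fromBlocks-tabulates k {λ i j → if ⌊ i + j ≟ k + 1 ⌋ then J₂ else zeroM}

antidiagonal-row : ∀ {k x} → x < k → antidiagonal k x ≗ single zeroM (k ∸ suc x) J₂
antidiagonal-row {k} {x} x<k y = if-⇔ (suc x + suc y ≟ k + 1) (y ≟ k ∸ suc x) (mk⇔ to from)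
  where
  k+1≡ : suc x + suc (k ∸ suc x) ≡ k + 1
  k+1≡ = trans (+-suc (suc x) (k ∸ suc x)) (trans (cong suc (m+[n∸m]≡n x<k)) (+-comm 1 k))
  to : suc x + suc y ≡ k + 1 → y ≡ k ∸ suc x
  to e = suc-injective (+-cancelˡ-≡ (suc x) _ _ (trans e (sym k+1≡)))
  from : y ≡ k ∸ suc x → suc x + suc y ≡ k + 1
  from refl = k+1≡

antidiagonal-beyond : ∀ {k x} → k ≤ x → antidiagonal k x ≗ const zeroM
antidiagonal-beyond {k} {x} k≤x y = if-no (suc x + suc y ≟ k + 1) (>⇒≢ k+1<)
  where
  k+1< : k + 1 < suc x + suc y
  k+1< = subst (_< suc x + suc y) (+-comm 1 k) (s≤s (≤-trans (s≤s k≤x) (m<m+n x (s≤s z≤n))))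

-- The blocks of γ for q = 3

nth-applyUpTo-++-< : ∀ {A : Set} (f : ℕ → A) n ys {i} → i < n →
                     nth (applyUpTo f n ++ ys) (suc i) ≡ just (f i)
nth-applyUpTo-++-< f (suc n) ys {zero}  _         = refl
nth-applyUpTo-++-< f (suc n) ys {suc i} (s≤s i<n) = nth-applyUpTo-++-< (f ∘ suc) n ys i<n

nth-applyUpTo-++-+ : ∀ {A : Set} (f : ℕ → A) n ys i →
                     nth (applyUpTo f n ++ ys) (suc (n + i)) ≡ nth ys (suc i)
nth-applyUpTo-++-+ f zero    ys i = refl
nth-applyUpTo-++-+ f (suc n) ys i = nth-applyUpTo-++-+ (f ∘ suc) n ys i

<cnt⇒≤ : ∀ {a k} → a < cnt k → + a ℤ.≤ k
<cnt⇒≤ {k = + n} (s≤s a≤n) = ℤ.+≤+ a≤n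

cnt≤⇒≰ : ∀ {a k} → cnt k ≤ a → ¬ (+ a ℤ.≤ k)
cnt≤⇒≰ {k = + n} n<a (ℤ.+≤+ a≤n) = <⇒≱ n<a a≤n

+[m+n]-+m : ∀ m n → + (m + n) ℤ.- + m ≡ + n
+[m+n]-+m m n =
  trans (ℤₚ.m-n≡m⊖n (m + n) m) (trans (ℤₚ.⊖-≥ (m≤m+n m n)) (cong +_ (m+n∸m≡n m n)))

suc≡+1⇔≡ : ∀ {a b} → (suc a ≡ b + 1) ⇔ (a ≡ b)
suc≡+1⇔≡ {a} {b} =
  mk⇔ (λ e → suc-injective (trans e (+-comm b 1))) (λ e → trans (cong suc e) (+-comm 1 b))

module Gamma₃ {p m h : ℕ} (count₁ : cnt (kk p 3 1) ≡ m) (count₂ : cnt (kk p 3 2) ≡ m + h)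
              (p≡ : p ≡ suc (m + m + h)) where

  pairs-layout : pairs p 3 ≡ applyUpTo (_, 1) m ++ (applyUpTo (_, 2) (m + h) ++ [])
  pairs-layout = trans
    (cong₂ (λ k₁ k₂ → map (_, 1) (upTo k₁) ++ (map (_, 2) (upTo k₂) ++ [])) count₁ count₂)
    (cong₂ (λ xs ys → xs ++ (ys ++ [])) (map-applyUpTo id (_, 1) m) (map-applyUpTo id (_, 2) (m + h)))

  nth-pairs₁ : ∀ {x} → x < m → nth (pairs p 3) (suc x) ≡ just (x , 1)
  nth-pairs₁ x<m rewrite pairs-layout = nth-applyUpTo-++-< (_, 1) m _ x<m

  nth-pairs₂ : ∀ {x} → x < m + h → nth (pairs p 3) (suc (m + x)) ≡ just (x , 2)
  nth-pairs₂ {x} x<m+h rewrite pairs-layout =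
    trans (nth-applyUpTo-++-+ (_, 1) m _ x) (nth-applyUpTo-++-< (_, 2) (m + h) [] x<m+h)

  nth-pairs-beyond : ∀ x → nth (pairs p 3) (suc (m + (m + (h + x)))) ≡ nothing
  nth-pairs-beyond x rewrite pairs-layout | sym (+-assoc m h x) =
    trans (nth-applyUpTo-++-+ (_, 1) m _ (m + h + x)) (nth-applyUpTo-++-+ (_, 2) (m + h) [] x)

  γ-row₁ : ∀ {x} y → x < m → γBlock p 3 2 (suc x) (suc y) ≡ single zeroM (m + x) I₂ y
  γ-row₁ {x} y x<m rewrite nth-pairs₁ x<m | count₁ =
    trans (if-yes (+ x ℤ.≤? kk p 3 2) (<cnt⇒≤ (subst (x <_) (sym count₂) (≤-trans x<m (m≤m+n m h)))))
          (if-⇔ (suc y ≟ m + x + 1) (y ≟ m + x) suc≡+1⇔≡)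

  γ-row₂ : ∀ {x} y → x < m → γBlock p 3 2 (suc (m + x)) (suc y) ≡ single zeroM x I₂ y
  γ-row₂ {x} y x<m rewrite nth-pairs₂ (≤-trans x<m (m≤m+n m h)) =
    trans (if-yes (+ x ℤ.≤? kk p 3 1) (<cnt⇒≤ (subst (x <_) (sym count₁) x<m)))
          (if-⇔ (suc y ≟ x + 1) (y ≟ x) suc≡+1⇔≡)

  γ-row₃ : ∀ {x} y → x < h →
           γBlock p 3 2 (suc (m + (m + x))) (suc y) ≡ single zeroM (m + (m + (h ∸ suc x))) J₂ y
  γ-row₃ {x} y x<h rewrite nth-pairs₂ (+-monoʳ-< m x<h) | count₁ =
    trans (if-no (+ (m + x) ℤ.≤? kk p 3 1) (cnt≤⇒≰ (subst (_≤ m + x) (sym count₁) (m≤m+n m x))))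
          (if-⇔ (+ suc y ℤ.≟ + m ℤ.+ + p ℤ.- + (m + x + 1)) (y ≟ column) (mk⇔ to from))
    where
    column = m + (m + (h ∸ suc x))
    m+p≡ : m + p ≡ m + x + 1 + suc column
    m+p≡ = begin
      m + p                                   ≡⟨ cong (_+_ m) p≡ ⟩
      m + suc (m + m + h)                     ≡⟨ cong (λ k → m + suc (m + m + k)) (m+[n∸m]≡n x<h) ⟨
      m + suc (m + m + (suc x + (h ∸ suc x))) ≡⟨ rearrange m x (h ∸ suc x) ⟩
      m + x + 1 + suc column                  ∎
      where
      open ≡-Reasoning
      rearrange : ∀ m x d → m + suc (m + m + (suc x + d)) ≡ m + x + 1 + suc (m + (m + d))
      rearrange = solve-∀
    J-column : + m ℤ.+ + p ℤ.- + (m + x + 1) ≡ + suc column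
    J-column = trans (cong (λ n → + n ℤ.- + (m + x + 1)) m+p≡) (+[m+n]-+m (m + x + 1) (suc column))
    to : + suc y ≡ + m ℤ.+ + p ℤ.- + (m + x + 1) → y ≡ column
    to e = suc-injective (ℤₚ.+-injective (trans e J-column))
    from : y ≡ column → + suc y ≡ + m ℤ.+ + p ℤ.- + (m + x + 1)
    from refl = sym J-column

  γ-row-beyond : ∀ x y → γBlock p 3 2 (suc (m + (m + (h + x)))) y ≡ zeroM
  γ-row-beyond x y rewrite nth-pairs-beyond x = refl

  zeroBlocks : ℕ → ℕ → Mat 2 2
  zeroBlocks _ _ = zeroM

  targetBlocks : ℕ → ℕ → Mat 2 2
  targetBlocks = block3ℕ m m zeroBlocks diagonal   zeroBlocks
                             diagonal   zeroBlocks zeroBlocks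
                             zeroBlocks zeroBlocks (antidiagonal h)

  γ-blocks : ∀ x y → γBlock p 3 2 (suc x) (suc y) ≡ targetBlocks x y
  γ-blocks x y with position m x
  ... | before x<m = begin
    γBlock p 3 2 (suc x) (suc y)                            ≡⟨ γ-row₁ y x<m ⟩
    single zeroM (m + x) I₂ y                               ≡⟨ concat₃-single₂ zeroM m m x<m y ⟨
    concat₃ m m (const zeroM) (diagonal x) (const zeroM) y  ≡⟨ cong-app (concat₃-first m m x<m) y ⟨
    targetBlocks x y                                        ∎
    where open ≡-Reasoning
  ... | after x′ with position m x′
  ...   | before x′<m = begin
    γBlock p 3 2 (suc (m + x′)) (suc y)                     ≡⟨ γ-row₂ y x′<m ⟩
    single zeroM x′ I₂ y                                    ≡⟨ concat₃-single₁ zeroM m m x′<m y ⟨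
    concat₃ m m (diagonal x′) (const zeroM) (const zeroM) y ≡⟨ cong-app (concat₃-second m m x′<m) y ⟨
    targetBlocks (m + x′) y                                 ∎
    where open ≡-Reasoning
  ...   | after x″ with position h x″
  ...     | before x″<h = begin
    γBlock p 3 2 (suc (m + (m + x″))) (suc y)
      ≡⟨ γ-row₃ y x″<h ⟩
    single zeroM (m + (m + (h ∸ suc x″))) J₂ y
      ≡⟨ concat₃-single₃ zeroM m m y ⟨
    concat₃ m m (const zeroM) (const zeroM) (single zeroM (h ∸ suc x″) J₂) y
      ≡⟨ concat₃-map m m id (λ _ → refl) (λ _ → refl) (antidiagonal-row x″<h) y ⟨
    concat₃ m m (const zeroM) (const zeroM) (antidiagonal h x″) y
      ≡⟨ cong-app (concat₃-third m m x″) y ⟨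
    targetBlocks (m + (m + x″)) y ∎
    where open ≡-Reasoning
  ...     | after x‴ = begin
    γBlock p 3 2 (suc (m + (m + (h + x‴)))) (suc y)
      ≡⟨ γ-row-beyond x‴ (suc y) ⟩
    zeroM
      ≡⟨ concat₃-const m m zeroM y ⟨
    concat₃ m m (const zeroM) (const zeroM) (const zeroM) y
      ≡⟨ concat₃-map m m id (λ _ → refl) (λ _ → refl) (antidiagonal-beyond (m≤m+n h x‴)) y ⟨
    concat₃ m m (const zeroM) (const zeroM) (antidiagonal h (h + x‴)) y
      ≡⟨ cong-app (concat₃-third m m (h + x‴)) y ⟨
    targetBlocks (m + (m + (h + x‴))) y ∎
    where open ≡-Reasoning

  γ-shape : (e : 2 * m + 2 * m + 2 * h ≡ 2 * genus p 3) → ∀ r c →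
            γ p 3 2 r c ≡ block3 zeroM (idM (2 * m)) zeroM
                                 (idM (2 * m)) zeroM zeroM
                                 zeroM zeroM (antidiagJ h)
                                 (cast (sym e) r) (cast (sym e) c)
  γ-shape e r c = begin
    γ p 3 2 r c
      ≡⟨ fromBlocks-tabulates (genus p 3) {γBlock p 3 2} r c ⟩
    blockEntries (λ x y → γBlock p 3 2 (suc x) (suc y)) (toℕ r) (toℕ c)
      ≡⟨ cong (λ M → M (parity (toℕ r)) (parity (toℕ c))) (γ-blocks (toℕ r / 2) (toℕ c / 2)) ⟩
    blockEntries targetBlocks (toℕ r) (toℕ c)
      ≡⟨ block3ℕ-blockEntries m m zeroBlocks diagonal   zeroBlocks
                                  diagonal   zeroBlocks zeroBlocks
                                  zeroBlocks zeroBlocks (antidiagonal h) (toℕ r) (toℕ c) ⟨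
    targetEntries (toℕ r) (toℕ c)
      ≡⟨ cong₂ targetEntries (Finₚ.toℕ-cast (sym e) r) (Finₚ.toℕ-cast (sym e) c) ⟨
    targetEntries (toℕ (cast (sym e) r)) (toℕ (cast (sym e) c))
      ≡⟨ block3-tabulates zero-tabulates (idM-tabulates (2 * m)) zero-tabulates
                          (idM-tabulates (2 * m)) zero-tabulates zero-tabulates
                          zero-tabulates zero-tabulates (antidiagJ-tabulates h)
                          (cast (sym e) r) (cast (sym e) c) ⟨
    block3 zeroM (idM (2 * m)) zeroM (idM (2 * m)) zeroM zeroM zeroM zeroM (antidiagJ h)
           (cast (sym e) r) (cast (sym e) c) ∎
    where
    open ≡-Reasoning
    O = blockEntries zeroBlocks
    targetEntries : ℕ → ℕ → ℤ
    targetEntries = block3ℕ (2 * m) (2 * m) O (blockEntries diagonal) O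
                                            (blockEntries diagonal) O O
                                            O O (blockEntries (antidiagonal h))
    zero-tabulates : ∀ {a b} → Tabulates O (zeroM {a} {b})
    zero-tabulates _ _ = refl

-- Arithmetic of p modulo 3

[m+kn]/n≡k : ∀ {m n} k .{{_ : ℕ.NonZero n}} → m < n → (m + k * n) / n ≡ k
[m+kn]/n≡k {m} {n} k m<n =
  trans (+-distrib-/-∣ʳ m (divides k refl)) (cong₂ _+_ (m<n⇒m/n≡0 m<n) (m*n/n≡m k n))

kk₃ : ∀ p b {k} → p * b ≡ 4 + k → kk p 3 b ≡ + (k / 3)
kk₃ p b eq rewrite eq = refl

genus₃ : ∀ p → genus p 3 ≡ p ∸ 1
genus₃ p = m*n/n≡m (p ∸ 1) 2

prime-mod-3 : ∀ {p} → Prime p → 3 < p → ∃ λ s → p ≡ 4 + s * 3 ⊎ p ≡ 5 + s * 3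
prime-mod-3 {p} p-prime 3<p = classify (p % 3) (p / 3) (m%n<n p 3) (m≡m%n+[m/n]*n p 3)
  where
  classify : ∀ r k → r < 3 → p ≡ r + k * 3 → ∃ λ s → p ≡ 4 + s * 3 ⊎ p ≡ 5 + s * 3
  classify 0 k _ p≡ = contradiction (composite 3<p (divides k p≡)) (Prime.notComposite p-prime)
  classify 1 0 _ refl = contradiction 3<p λ { (s≤s ()) }
  classify 2 0 _ refl = contradiction 3<p λ { (s≤s (s≤s ())) }
  classify 1 (suc s) _ p≡ = s , inj₁ p≡
  classify 2 (suc s) _ p≡ = s , inj₂ p≡
  classify (suc (suc (suc _))) _ (s≤s (s≤s (s≤s ()))) _

module _ {p : ℕ} where

  private
    m = (p ∸ 4) / 3 + 1
    h = genus p 3 ∸ 2 * m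

  excess≡ : ∀ s h₀ → m ≡ suc s → p ≡ suc (suc s + suc s + h₀) → h ≡ h₀
  excess≡ s h₀ m≡ p≡ rewrite genus₃ p | m≡ | p≡ =
    trans (cong (_∸ 2 * suc s) (double s h₀)) (m+n∸m≡n (2 * suc s) h₀)
    where
    double : ∀ s h₀ → suc s + suc s + h₀ ≡ 2 * suc s + h₀
    double = solve-∀

  counts₃ : ∀ s h₀ → m ≡ suc s → p ≡ suc (suc s + suc s + h₀) →
            kk p 3 1 ≡ + s → kk p 3 2 ≡ + (s + h₀) →
            cnt (kk p 3 1) ≡ m × cnt (kk p 3 2) ≡ m + h × p ≡ suc (m + m + h)
  counts₃ s h₀ m≡ p≡ k₁ k₂ rewrite excess≡ s h₀ m≡ p≡ | m≡ | k₁ | k₂ = refl , refl , p≡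

  prime-counts₃ : Prime p → 3 < p →
                  cnt (kk p 3 1) ≡ m × cnt (kk p 3 2) ≡ m + h × p ≡ suc (m + m + h)
  prime-counts₃ p-prime 3<p with prime-mod-3 p-prime 3<p
  ... | s , inj₁ refl = counts₃ s (suc s) m≡ (p≡ s)
        (trans (kk₃ p 1 (*-identityʳ p)) (cong +_ ([m+kn]/n≡k s (s≤s z≤n))))
        (trans (kk₃ p 2 (p*2≡ s)) (cong +_ ([m+kn]/n≡k (s + suc s) (s≤s (s≤s z≤n)))))
    where
    m≡ = trans (cong (_+ 1) ([m+kn]/n≡k s (s≤s z≤n))) (+-comm s 1)
    p≡ : ∀ s → 4 + s * 3 ≡ suc (suc s + suc s + suc s)
    p≡ = solve-∀
    p*2≡ : ∀ s → (4 + s * 3) * 2 ≡ 4 + (1 + (s + suc s) * 3)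
    p*2≡ = solve-∀
  ... | s , inj₂ refl = counts₃ s (suc (suc s)) m≡ (p≡ s)
        (trans (kk₃ p 1 (*-identityʳ p)) (cong +_ ([m+kn]/n≡k s (s≤s (s≤s z≤n)))))
        (trans (kk₃ p 2 (p*2≡ s)) (cong +_ ([m+kn]/n≡k (s + suc (suc s)) (s≤s z≤n))))
    where
    m≡ = trans (cong (_+ 1) ([m+kn]/n≡k s (s≤s (s≤s z≤n)))) (+-comm s 1)
    p≡ : ∀ s → 5 + s * 3 ≡ suc (suc s + suc s + suc (suc s))
    p≡ = solve-∀
    p*2≡ : ∀ s → (5 + s * 3) * 2 ≡ 4 + (0 + (s + suc (suc s)) * 3)
    p*2≡ = solve-∀

doubled-genus : ∀ {p m h} → p ≡ suc (m + m + h) → 2 * m + 2 * m + 2 * h ≡ 2 * genus p 3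
doubled-genus {p} {m} {h} p≡ =
  trans (distrib m h) (cong (_*_ 2) (sym (trans (genus₃ p) (cong (_∸ 1) p≡))))
  where
  distrib : ∀ m h → 2 * m + 2 * m + 2 * h ≡ 2 * (m + m + h)
  distrib = solve-∀

corollary4p8 : (p : ℕ) → Prime p → 3 < p →
    let g = genus p 3
        m = (p ∸ 4) / 3 + 1
    in Σ (2 * m + 2 * m + 2 * (g ∸ 2 * m) ≡ 2 * g) λ e →
       ∀ r c → γ p 3 2 r c
         ≡ block3 zeroM (idM (2 * m)) zeroM
                  (idM (2 * m)) zeroM zeroM
                  zeroM zeroM (antidiagJ (g ∸ 2 * m))
                  (cast (sym e) r) (cast (sym e) c)
corollary4p8 p p-prime 3<p with prime-counts₃ p-prime 3<p
... | count₁ , count₂ , p≡ = e , Gamma₃.γ-shape count₁ count₂ p≡ e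
  where
  m = (p ∸ 4) / 3 + 1
  e = doubled-genus {p} {m} {genus p 3 ∸ 2 * m} p≡
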